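{- For every integer $k\ge2$, $\mathrm{Pol}(\mathbf K_k,\mathbf K_{2k})$ contains an Olšák function.
   Context: $\mathbf K_n$ ($n\ge2$) has domain $\{0,\dots,n-1\}$ and the binary relation $\ne$. $\mathrm{Pol}(\mathbf K_k,\mathbf K_c)$ is the set of maps $f\colon\{0,\dots,k-1\}^n\to\{0,\dots,c-1\}$ with $f(\mathbf a)\ne f(\mathbf b)$ whenever $a_i\ne b_i$ for all $i$. An Olšák function is a $6$-ary $o$ with $o(x,x,y,y,y,x)=o(x,y,x,y,x,y)=o(y,x,x,x,y,y)$ for all $x,y$. -}

module Defs where

open import Data.Nat using (ℕ)
open import Data.Fin using (Fin)
open import Data.Fin.Patterns using (0F; 1F; 2F; 3F; 4F; 5F)
open import Data.Product using (Σ; _×_)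
open import Relation.Binary.PropositionalEquality using (_≡_; _≢_)

-- n-ary polymorphisms from K_k to K_c: maps f : (Fin n → Fin k) → Fin c
-- such that f a ≢ f b whenever a i ≢ b i for every coordinate i.
IsPol : (n k c : ℕ) → ((Fin n → Fin k) → Fin c) → Set
IsPol n k c f = (a b : Fin n → Fin k) → (∀ i → a i ≢ b i) → f a ≢ f b

tuple6 : ∀ {A : Set} → A → A → A → A → A → A → Fin 6 → A
tuple6 a b c d e g 0F = a
tuple6 a b c d e g 1F = b
tuple6 a b c d e g 2F = c
tuple6 a b c d e g 3F = d
tuple6 a b c d e g 4F = e
tuple6 a b c d e g 5F = g

IsOlsak : ∀ {A B : Set} → ((Fin 6 → A) → B) → Set
IsOlsak {A} o = (x y : A) →
  (o (tuple6 x x y y y x) ≡ o (tuple6 x y x y x y)) ×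
  (o (tuple6 x y x y x y) ≡ o (tuple6 y x x x y y))

module Submission where

-- Call a nonempty set S of coordinates of Fin n → A monochromatic
-- for a tuple a if a is constant on S.  Fix a family F of coordinate sets
-- that pairwise intersect, and a fallback coordinate i₀.  Map a tuple a to
--   inj₁ v       if a is constant with value v on some member of F,
--   inj₂ (a i₀)  otherwise.
-- The colour v is well defined, since two members of F share a coordinate.
-- This map sends coordinatewise-distinct tuples to distinct values of A ⊎ A:
-- two tuples of the first kind with equal colours agree on a shared
-- coordinate, and two of the second kind agree at i₀.  So composing it with
-- an injection Fin k ⊎ Fin k → Fin (2 * k) gives a polymorphism K_k → K_2k.
--
-- For the Olšák identities take n = 6 and F = {{0,1,5},{0,2,4},{1,2,3}}:
-- the three Olšák tuples (x,x,y,y,y,x), (x,y,x,y,x,y), (y,x,x,x,y,y) are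
-- constant x on the first, second and third member respectively, so all
-- three receive the colour x.

open import Defs
open import Data.Nat using (ℕ; _≤_; _*_; _+_)
open import Data.Fin using (Fin; _↑ˡ_; join; splitAt)
open import Data.Fin.Properties using (_≟_; ↑ˡ-injective; splitAt-join)
open import Data.Fin.Patterns using (0F; 1F; 2F; 3F; 4F; 5F)
open import Data.List using (List; []; _∷_)
open import Data.List.NonEmpty using (List⁺; _∷_; toList)
open import Data.List.Relation.Unary.All as All using (All; []; _∷_; all?)
open import Data.List.Relation.Unary.Any using (Any; here; there; any?)
open import Data.List.Relation.Unary.Any.Properties using (lookup-result)
open import Data.List.Membership.Propositional using (_∈_; lose)
import Data.List.Membership.DecPropositional as DecMembership
open import Data.Product using (Σ; _×_; _,_; proj₁; proj₂)
open import Data.Sum as Sum using (_⊎_; inj₁; inj₂)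
open import Data.Sum.Properties using (inj₁-injective; inj₂-injective)
open import Data.Empty using (⊥-elim)
open import Function using (_∘_)
open import Relation.Nullary using (Dec; yes; no; map′)
open import Relation.Nullary.Decidable using (toWitness)
open import Relation.Binary.Definitions using (DecidableEquality)
open import Relation.Binary.PropositionalEquality
  using (_≡_; _≢_; refl; sym; trans; cong)

Intersect : ∀ {n} → List⁺ (Fin n) → List⁺ (Fin n) → Set
Intersect S T = Any (_∈ toList T) (toList S)

Intersecting : ∀ {n} → List (List⁺ (Fin n)) → Set
Intersecting F = All (λ S → All (Intersect S) F) F

intersecting? : ∀ {n} (F : List (List⁺ (Fin n))) → Dec (Intersecting F)
intersecting? F = all? (λ S → all? (intersect? S) F) F
  where
  intersect? : ∀ {n} (S T : List⁺ (Fin n)) → Dec (Intersect S T)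
  intersect? S T = any? (λ i → DecMembership._∈?_ _≟_ i (toList T)) (toList S)

module ColouringByFamily {n : ℕ} {A : Set} (_≟ᴬ_ : DecidableEquality A) where

  ConstantOn : (Fin n → A) → List⁺ (Fin n) → A → Set
  ConstantOn a S v = All (λ i → a i ≡ v) (toList S)

  Monochromatic : (Fin n → A) → List⁺ (Fin n) → Set
  Monochromatic a S = Σ A (ConstantOn a S)

  monochromatic? : (a : Fin n → A) (S : List⁺ (Fin n)) → Dec (Monochromatic a S)
  monochromatic? a (h ∷ r) =
    map′ (λ agree → a h , refl ∷ agree)
         (λ { (v , ah≡v ∷ rest) → All.map (λ ai≡v → trans ai≡v (sym ah≡v)) rest })
         (all? (λ i → a i ≟ᴬ a h) r)

  common-point : ∀ {a b S T v w} → ConstantOn a S v → ConstantOn b T w →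
    Intersect S T → Σ (Fin n) (λ i → a i ≡ v × b i ≡ w)
  common-point a≡v b≡w S∩T with All.lookupAny a≡v S∩T
  ... | ai≡v , i∈T = _ , ai≡v , All.lookup b≡w i∈T

  colour-unique : ∀ {a S T v w} → ConstantOn a S v → ConstantOn a T w →
    Intersect S T → v ≡ w
  colour-unique a≡v a≡w S∩T with common-point a≡v a≡w S∩T
  ... | _ , ai≡v , ai≡w = trans (sym ai≡v) ai≡w

  module Colouring (F : List (List⁺ (Fin n))) (intersecting : Intersecting F)
                   (i₀ : Fin n) where

    colourWith : (a : Fin n → A) → Dec (Any (Monochromatic a) F) → A ⊎ A
    colourWith a (yes m) = inj₁ (proj₁ (lookup-result m))
    colourWith a (no _)  = inj₂ (a i₀)

    colour : (Fin n → A) → A ⊎ A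
    colour a = colourWith a (any? (monochromatic? a) F)

    colour-constant : ∀ {a S v} → S ∈ F → ConstantOn a S v → colour a ≡ inj₁ v
    colour-constant {a} {S} {v} S∈F a≡v = go (any? (monochromatic? a) F)
      where
      go : (d : Dec (Any (Monochromatic a) F)) → colourWith a d ≡ inj₁ v
      go (yes m) = cong inj₁ (colour-unique (proj₂ (lookup-result m)) a≡v
                     (All.lookup (proj₁ (All.lookupAny intersecting m)) S∈F))
      go (no none) = ⊥-elim (none (lose S∈F (v , a≡v)))

    colour-separates : (a b : Fin n → A) → (∀ i → a i ≢ b i) → colour a ≢ colour b
    colour-separates a b a≢b = go (any? (monochromatic? a) F) (any? (monochromatic? b) F)
      where
      go : (da : Dec (Any (Monochromatic a) F)) (db : Dec (Any (Monochromatic b) F)) →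
        colourWith a da ≢ colourWith b db
      go (yes ma) (yes mb) same-colour
        with common-point (proj₂ (lookup-result ma)) (proj₂ (lookup-result mb))
               (proj₁ (All.lookupAny (proj₁ (All.lookupAny intersecting ma)) mb))
      ... | i , ai≡v , bi≡w = a≢b i (trans ai≡v (trans (inj₁-injective same-colour) (sym bi≡w)))
      go (no _)   (no _)   same-colour = a≢b i₀ (inj₂-injective same-colour)
      go (yes _)  (no _)   ()
      go (no _)   (yes _)  ()

-- Fin k ⊎ Fin k as the two halves of Fin (2 * k) = Fin (k + (k + 0))
twoCopies : ∀ {k} → Fin k ⊎ Fin k → Fin (2 * k)
twoCopies {k} = join k (k + 0) ∘ Sum.map₂ (_↑ˡ 0)

-- injectivity follows from splitAt being a left inverse of join
twoCopies-injective : ∀ {k} (u v : Fin k ⊎ Fin k) → twoCopies u ≡ twoCopies v → u ≡ v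
twoCopies-injective {k} u v eq = padding-injective u v (unjoin eq)
  where
  unjoin : twoCopies u ≡ twoCopies v → Sum.map₂ (_↑ˡ 0) u ≡ Sum.map₂ (_↑ˡ 0) v
  unjoin e = trans (sym (splitAt-join k (k + 0) (Sum.map₂ (_↑ˡ 0) u)))
                   (trans (cong (splitAt k) e) (splitAt-join k (k + 0) (Sum.map₂ (_↑ˡ 0) v)))

  padding-injective : (u v : Fin k ⊎ Fin k) →
    Sum.map₂ (_↑ˡ 0) u ≡ Sum.map₂ (_↑ˡ 0) v → u ≡ v
  padding-injective (inj₁ _) (inj₁ _) refl = refl
  padding-injective (inj₂ x) (inj₂ y) e = cong inj₂ (↑ˡ-injective 0 x y (inj₂-injective e))
  padding-injective (inj₁ _) (inj₂ _) ()
  padding-injective (inj₂ _) (inj₁ _) ()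

olšákFamily : List (List⁺ (Fin 6))
olšákFamily = (0F ∷ 1F ∷ 5F ∷ []) ∷ (0F ∷ 2F ∷ 4F ∷ []) ∷ (1F ∷ 2F ∷ 3F ∷ []) ∷ []

olšákFamily-intersecting : Intersecting olšákFamily
olšákFamily-intersecting = toWitness {a? = intersecting? olšákFamily} _

proposition10p1 : (k : ℕ) → 2 ≤ k →
    Σ ((Fin 6 → Fin k) → Fin (2 * k)) (λ o → IsPol 6 k (2 * k) o × IsOlsak o)
proposition10p1 k _ = twoCopies ∘ colour , isPol , isOlsak
  where
  open ColouringByFamily (_≟_ {k})
  open Colouring olšákFamily olšákFamily-intersecting 0F

  isPol : IsPol 6 k (2 * k) (twoCopies ∘ colour)
  isPol a b a≢b = colour-separates a b a≢b ∘ twoCopies-injective (colour a) (colour b)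

  isOlsak : IsOlsak (twoCopies ∘ colour)
  isOlsak x y = cong twoCopies (trans first (sym second))
              , cong twoCopies (trans second (sym third))
    where
    first : colour (tuple6 x x y y y x) ≡ inj₁ x
    first = colour-constant (here refl) (refl ∷ refl ∷ refl ∷ [])
    second : colour (tuple6 x y x y x y) ≡ inj₁ x
    second = colour-constant (there (here refl)) (refl ∷ refl ∷ refl ∷ [])
    third : colour (tuple6 y x x x y y) ≡ inj₁ x
    third = colour-constant (there (there (here refl))) (refl ∷ refl ∷ refl ∷ [])
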